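{- Let $\sigma_{\mathrm{min}}=\sum_{k\ge 0}a_kt^k\in\mathbb{F}_2[[t]]$ be the power series produced by the following $2$-automaton with five states $A,B,C,D,E$, start state $A$, output labels $A\mapsto 0$, $B\mapsto 1$, $C\mapsto 1$, $D\mapsto 1$, $E\mapsto 0$, and transitions (written as state $\xrightarrow{\text{digit}}$ state): $A\xrightarrow{0}A$, $A\xrightarrow{1}B$; $B\xrightarrow{0}C$, $B\xrightarrow{1}E$; $C\xrightarrow{0}C$, $C\xrightarrow{1}B$; $D\xrightarrow{0}B$, $D\xrightarrow{1}D$; $E\xrightarrow{0}E$, $E\xrightarrow{1}D$. Then $\sigma_{\mathrm{min}}$ is an element of order $4$ of the Nottingham group $\mathcal{N}(\mathbb{F}_2)$, it has lower break sequence $(1,3)$, and $\sigma_{\mathrm{min}}=t+t^2+t^4+t^5+O(t^6)$.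
   Context: The Nottingham group $\mathcal{N}(\mathbb{F}_2)$ is the group of power series $\sigma(t)=t+a_2t^2+a_3t^3+\cdots\in\mathbb{F}_2[[t]]$ under composition $(\sigma\circ\tau)(t)=\sigma(\tau(t))$; $\sigma^{\circ N}$ denotes the $N$-fold composite. The depth of $\sigma\ne t$ is $d(\sigma)=\mathrm{ord}_t(\sigma(t)-t)-1$. For $\sigma$ of order $2^n$ the lower break sequence is $(d(\sigma^{\circ 2^i}))_{i=0}^{n-1}$. A $2$-automaton produces the sequence $(a_k)_{k\ge0}$ where $a_k$ is the output label of the state reached from the start state by following the binary digits of $k$ starting with the least significant digit (for $k=0$, the empty word, so $a_0$ is the label of the start state); the associated power series is $\sum a_kt^k$. -}

module Defs where

open import Data.Bool using (Bool; true; false; _xor_; _∧_; if_then_else_)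
open import Data.Nat using (ℕ; zero; suc; _∸_; _<_; _≡ᵇ_; ⌊_/2⌋)
open import Data.Product using (_×_)
open import Relation.Binary.PropositionalEquality using (_≡_; _≢_)
open import Relation.Nullary using (¬_)

-- Formal power series over 𝔽₂, represented by their coefficient sequences
-- (false = 0, true = 1; addition is xor, multiplication is ∧).
PS : Set
PS = ℕ → Bool

_≈ₚ_ : PS → PS → Set
f ≈ₚ g = ∀ n → f n ≡ g n

tₚ : PS
tₚ n = n ≡ᵇ 1

oneₚ : PS
oneₚ n = n ≡ᵇ 0

Σ≤ : ℕ → (ℕ → Bool) → Bool
Σ≤ zero f = f 0
Σ≤ (suc n) f = Σ≤ n f xor f (suc n)

_*ₚ_ : PS → PS → PS
(f *ₚ g) n = Σ≤ n (λ i → f i ∧ g (n ∸ i))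

_^ₚ_ : PS → ℕ → PS
f ^ₚ zero = oneₚ
f ^ₚ suc k = f *ₚ (f ^ₚ k)

-- For τ with zero constant
-- term (all elements of the Nottingham group), τ^k = O(t^k), so the
-- coefficient of t^n only receives contributions from k ≤ n.
_∘ₚ_ : PS → PS → PS
(σ ∘ₚ τ) n = Σ≤ n (λ k → σ k ∧ (τ ^ₚ k) n)

iter : PS → ℕ → PS
iter σ zero = tₚ
iter σ (suc N) = σ ∘ₚ iter σ N

Nottingham : PS → Set
Nottingham σ = (σ 0 ≡ false) × (σ 1 ≡ true)

HasOrder : PS → ℕ → Set
HasOrder σ N = (iter σ N ≈ₚ tₚ) × (∀ M → 0 < M → M < N → ¬ (iter σ M ≈ₚ tₚ))

-- Depth d(σ) = ord_t(σ(t) - t) - 1 = d : the coefficients of σ and t agree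
-- below degree d+1 and differ in degree d+1.
HasDepth : PS → ℕ → Set
HasDepth σ d = (∀ m → m < suc d → σ m ≡ tₚ m) × (σ (suc d) ≢ tₚ (suc d))

isOdd : ℕ → Bool
isOdd zero = false
isOdd (suc zero) = true
isOdd (suc (suc n)) = isOdd n

data State : Set where
  A B C D E : State

δ : State → Bool → State
δ A false = A
δ A true  = B
δ B false = C
δ B true  = E
δ C false = C
δ C true  = B
δ D false = B
δ D true  = D
δ E false = E
δ E true  = D

label : State → Bool
label A = false
label B = true
label C = true
label D = true
label E = false

-- Feed the binary digits of k, least significant first (no leading zeros;
-- k = 0 is the empty word).  The fuel argument (≥ number of digits) only
-- ensures structural termination.
runFuel : ℕ → State → ℕ → State
runFuel zero s k = s
runFuel (suc f) s zero = s
runFuel (suc f) s (suc k) =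
  runFuel f (δ s (isOdd (suc k))) ⌊ suc k /2⌋

run : ℕ → State
run k = runFuel k A k

σmin : PS
σmin k = label (run k)

-- The series S_s of the five states satisfy the Mahler equations S_s = S_{δ(s,0)}² + t·S_{δ(s,1)}²,
-- since squaring over 𝔽₂ moves the coefficient of t^m to t^{2m}. Eliminating the other states
-- from these equations (ideal-membership certificates checked by the ring solver, together with
-- cancellation of factors of known t-adic valuation, 𝔽₂[[t]] having no zero divisors) gives
-- F(t, σ) = 0 for σ = σmin. Substituting an iterate τ = σ^{∘k} for t is a ring homomorphism, so
-- F(σ^{∘k}, σ^{∘(k+1)}) = 0 for all k, and eliminating the middle iterate yields
-- H(σ^{∘k}, σ^{∘(k+2)}) = 0 for a symmetric H. Hence H(σ^{∘2}, σ^{∘4}) = H(σ^{∘2}, t) = 0, and as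
-- H(x, y) − H(x, z) = (y − z)·W(x, y, z) with W a unit, σ^{∘4} = t. The remaining claims are
-- finite computations of coefficients.

module Submission where

open import Algebra.Bundles using (CommutativeMonoid; CommutativeRing; CommutativeSemiring; RawRing)
open import Algebra.Structures using (IsCommutativeMonoid)
import Algebra.Structures.Biased as Biased
open import Algebra.Morphism.Structures using (module SemiringMorphisms)
open import Algebra.Solver.Ring.AlmostCommutativeRing
  using (AlmostCommutativeRing; fromCommutativeSemiring; _-Raw-AlmostCommutative⟶_)
import Algebra.Construct.Pointwise as Pointwise
import Algebra.Properties.CommutativeSemigroup as CommSemigroupProperties
open import Data.Bool using (Bool; true; false; _xor_; _∧_)
open import Data.Bool.Properties
  using (∧-comm; ∧-assoc; ∧-zeroʳ; ∧-identityʳ; ∧-idem; ∧-commutativeMonoid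
        ; xor-identityʳ; xor-same; ∧-distribˡ-xor; ∧-distribʳ-xor; xor-∧-commutativeRing)
  renaming (_≟_ to _≟ᵇ_)
open import Data.Bool.Solver using (module xor-∧-Solver)
open import Data.Fin using (#_; zero; suc)
open import Data.Maybe using (Maybe; just; nothing)
open import Data.Nat
  using (ℕ; NonZero; zero; suc; _+_; _∸_; _≤_; _<_; _≤′_; ≤′-refl; ≤′-step; z≤n; s≤s; s<s; _≡ᵇ_; ⌊_/2⌋)
open import Data.Nat.Induction using (<-rec)
open import Data.Nat.Properties
  using (_≟_; _≤?_; ≤-refl; ≤-trans; ≤-pred; m≤n⇒m≤1+n; <⇒≢; ≤∧≢⇒<; ≰⇒>; <⇒≱; ≤⇒≤′; ≤′⇒≤
        ; m∸n≤m; +-comm; +-assoc; <-cmp; ∸-monoʳ-<; <-≤-trans; m≤m+n; m+n∸m≡n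
        ; +-suc; ⌊n/2⌋<n; n≡⌊n+n/2⌋; n≡⌈n+n/2⌉)
open import Data.Product using (_×_; _,_; ∃-syntax)
open import Data.Sum using (_⊎_; inj₁; inj₂)
open import Data.Vec using (Vec; []; _∷_; lookup; replicate)
open import Data.Vec.Properties using (lookup-replicate)
open import Function using (_∘_)
open import Level using (0ℓ)
open import Relation.Binary.Definitions using (tri<; tri≈; tri>)
open import Relation.Binary.PropositionalEquality
open import Relation.Nullary using (¬_; yes; no; contradiction)
open import Relation.Nullary.Decidable using (dec-true; dec-false)

open import Defs

open ≡-Reasoning

-- Indicators and finite sums over 𝔽₂

≡ᵇ-refl : ∀ n → (n ≡ᵇ n) ≡ true
≡ᵇ-refl n = dec-true (n ≟ n) refl

≡ᵇ-sym : ∀ m n → (m ≡ᵇ n) ≡ (n ≡ᵇ m)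
≡ᵇ-sym zero    zero    = refl
≡ᵇ-sym zero    (suc n) = refl
≡ᵇ-sym (suc m) zero    = refl
≡ᵇ-sym (suc m) (suc n) = ≡ᵇ-sym m n

≢⇒≡ᵇ-false : ∀ {m n} → m ≢ n → (m ≡ᵇ n) ≡ false
≢⇒≡ᵇ-false {m} {n} = dec-false (m ≟ n)

+≡ᵇ⇔≡ᵇ∸ : ∀ {i n} j → i ≤ n → (i + j ≡ᵇ n) ≡ (j ≡ᵇ n ∸ i)
+≡ᵇ⇔≡ᵇ∸ j z≤n       = refl
+≡ᵇ⇔≡ᵇ∸ j (s≤s i≤n) = +≡ᵇ⇔≡ᵇ∸ j i≤n

>⇒+≡ᵇ-false : ∀ {i n} j → n < i → (i + j ≡ᵇ n) ≡ false
>⇒+≡ᵇ-false {suc i} {zero}  j _         = refl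
>⇒+≡ᵇ-false {suc i} {suc n} j (s<s n<i) = >⇒+≡ᵇ-false j n<i

xor-interchange : ∀ a b c d → (a xor b) xor (c xor d) ≡ (a xor c) xor (b xor d)
xor-interchange = solve 4 (λ a b c d → (a :+ b) :+ (c :+ d) := (a :+ c) :+ (b :+ d)) refl
  where open xor-∧-Solver

open CommSemigroupProperties (CommutativeMonoid.commutativeSemigroup ∧-commutativeMonoid) using ()
  renaming (interchange to ∧-interchange; xy∙z≈xz∙y to ∧-swapʳ)

Σ≤-cong≤ : ∀ n {f g : ℕ → Bool} → (∀ i → i ≤ n → f i ≡ g i) → Σ≤ n f ≡ Σ≤ n g
Σ≤-cong≤ zero    f≡g = f≡g 0 z≤n
Σ≤-cong≤ (suc n) f≡g = cong₂ _xor_ (Σ≤-cong≤ n (λ i → f≡g i ∘ m≤n⇒m≤1+n)) (f≡g (suc n) ≤-refl)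

Σ≤-cong : ∀ n {f g : ℕ → Bool} → f ≗ g → Σ≤ n f ≡ Σ≤ n g
Σ≤-cong n f≗g = Σ≤-cong≤ n (λ i _ → f≗g i)

Σ≤-zero : ∀ n {f : ℕ → Bool} → (∀ i → i ≤ n → f i ≡ false) → Σ≤ n f ≡ false
Σ≤-zero zero    f≡0 = f≡0 0 z≤n
Σ≤-zero (suc n) f≡0 = cong₂ _xor_ (Σ≤-zero n (λ i → f≡0 i ∘ m≤n⇒m≤1+n)) (f≡0 (suc n) ≤-refl)

Σ≤-point : ∀ n k {f : ℕ → Bool} → k ≤ n → (∀ i → i ≤ n → i ≢ k → f i ≡ false) → Σ≤ n f ≡ f k
Σ≤-point zero    zero    _    _   = refl
Σ≤-point (suc n) k {f} k≤1+n off with k ≟ suc n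
... | yes refl = cong (_xor f k) (Σ≤-zero n (λ i i≤n → off i (m≤n⇒m≤1+n i≤n) (<⇒≢ (s≤s i≤n))))
... | no k≢1+n = begin
  Σ≤ n f xor f (suc n) ≡⟨ cong₂ _xor_ (Σ≤-point n k (≤-pred (≤∧≢⇒< k≤1+n k≢1+n)) (λ i → off i ∘ m≤n⇒m≤1+n))
                                      (off (suc n) ≤-refl (k≢1+n ∘ sym)) ⟩
  f k xor false        ≡⟨ xor-identityʳ (f k) ⟩
  f k                  ∎

Σ≤-xor : ∀ n (f g : ℕ → Bool) → Σ≤ n (λ i → f i xor g i) ≡ Σ≤ n f xor Σ≤ n g
Σ≤-xor zero    f g = refl
Σ≤-xor (suc n) f g = trans (cong (_xor (f (suc n) xor g (suc n))) (Σ≤-xor n f g))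
                           (xor-interchange (Σ≤ n f) (Σ≤ n g) (f (suc n)) (g (suc n)))

Σ≤-∧ˡ : ∀ n b (f : ℕ → Bool) → b ∧ Σ≤ n f ≡ Σ≤ n (λ i → b ∧ f i)
Σ≤-∧ˡ zero    b f = refl
Σ≤-∧ˡ (suc n) b f = trans (∧-distribˡ-xor b (Σ≤ n f) (f (suc n))) (cong (_xor (b ∧ f (suc n))) (Σ≤-∧ˡ n b f))

Σ≤-∧ʳ : ∀ n b (f : ℕ → Bool) → Σ≤ n f ∧ b ≡ Σ≤ n (λ i → f i ∧ b)
Σ≤-∧ʳ zero    b f = refl
Σ≤-∧ʳ (suc n) b f = trans (∧-distribʳ-xor b (Σ≤ n f) (f (suc n))) (cong (_xor (f (suc n) ∧ b)) (Σ≤-∧ʳ n b f))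

Σ≤-swap : ∀ n m (f : ℕ → ℕ → Bool) → Σ≤ n (λ i → Σ≤ m (f i)) ≡ Σ≤ m (λ j → Σ≤ n (λ i → f i j))
Σ≤-swap zero    m f = refl
Σ≤-swap (suc n) m f = trans (cong (_xor Σ≤ m (f (suc n))) (Σ≤-swap n m f))
                            (sym (Σ≤-xor m (λ j → Σ≤ n (λ i → f i j)) (f (suc n))))

Σ≤-extend : ∀ {n N} {f : ℕ → Bool} → n ≤ N → (∀ i → n < i → f i ≡ false) → Σ≤ N f ≡ Σ≤ n f
Σ≤-extend {n} {f = f} n≤N f≡0 = go (≤⇒≤′ n≤N)
  where
  go : ∀ {N} → n ≤′ N → Σ≤ N f ≡ Σ≤ n f
  go ≤′-refl            = refl
  go (≤′-step {M} n≤′M) = begin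
    Σ≤ M f xor f (suc M) ≡⟨ cong₂ _xor_ (go n≤′M) (f≡0 (suc M) (s≤s (≤′⇒≤ n≤′M))) ⟩
    Σ≤ n f xor false      ≡⟨ xor-identityʳ _ ⟩
    Σ≤ n f                ∎

Σ≤-select : ∀ N a (X : ℕ → Bool) → (N < a → X a ≡ false) → Σ≤ N (λ m → X m ∧ (m ≡ᵇ a)) ≡ X a
Σ≤-select N a X beyond with a ≤? N
... | yes a≤N = trans (Σ≤-point N a a≤N (λ i _ i≢a → trans (cong (X i ∧_) (≢⇒≡ᵇ-false i≢a)) (∧-zeroʳ (X i))))
                      (trans (cong (X a ∧_) (≡ᵇ-refl a)) (∧-identityʳ (X a)))
... | no a≰N  = trans (Σ≤-zero N (λ i i≤N → trans (cong (X i ∧_) (≢⇒≡ᵇ-false {i} (λ { refl → a≰N i≤N }))) (∧-zeroʳ (X i))))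
                      (sym (beyond (≰⇒> a≰N)))

Σ≤-diagonal : ∀ N (a : ℕ → ℕ → Bool) → (∀ i j → a i j ≡ a j i) → Σ≤ N (λ i → Σ≤ N (a i)) ≡ Σ≤ N (λ i → a i i)
Σ≤-diagonal zero    a symmetric = refl
Σ≤-diagonal (suc N) a symmetric = begin
  Σ≤ N (λ i → Σ≤ N (a i) xor a i (suc N)) xor (row xor corner)
    ≡⟨ cong (_xor (row xor corner)) (Σ≤-xor N (λ i → Σ≤ N (a i)) (λ i → a i (suc N))) ⟩
  (Σ≤ N (λ i → Σ≤ N (a i)) xor Σ≤ N (λ i → a i (suc N))) xor (row xor corner)
    ≡⟨ cong₂ (λ x y → (x xor y) xor (row xor corner)) (Σ≤-diagonal N a symmetric) (Σ≤-cong N (λ i → symmetric i (suc N))) ⟩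
  (Σ≤ N (λ i → a i i) xor row) xor (row xor corner)
    ≡⟨ xor-cancel-middle (Σ≤ N (λ i → a i i)) row corner ⟩
  Σ≤ N (λ i → a i i) xor corner
    ∎
  where
  row corner : Bool
  row    = Σ≤ N (a (suc N))
  corner = a (suc N) (suc N)
  xor-cancel-middle : ∀ x y z → (x xor y) xor (y xor z) ≡ x xor z
  xor-cancel-middle = solve 3 (λ x y z → (x :+ y) :+ (y :+ z) := x :+ z) refl
    where open xor-∧-Solver

Σ²-∧ʳ : ∀ n (Q : ℕ → ℕ → Bool) c → Σ≤ n (λ i → Σ≤ n (Q i)) ∧ c ≡ Σ≤ n (λ i → Σ≤ n (λ j → Q i j ∧ c))
Σ²-∧ʳ n Q c = trans (Σ≤-∧ʳ n c _) (Σ≤-cong n (λ i → Σ≤-∧ʳ n c (Q i)))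

Σ≤-∧-Σ≤ : ∀ N M (x y : ℕ → Bool) → Σ≤ N x ∧ Σ≤ M y ≡ Σ≤ N (λ i → Σ≤ M (λ j → x i ∧ y j))
Σ≤-∧-Σ≤ N M x y = trans (Σ≤-∧ʳ N (Σ≤ M y) x) (Σ≤-cong N (λ i → Σ≤-∧ˡ M (x i) y))

-- The semiring of power series over 𝔽₂

infixl 6 _+ₚ_
_+ₚ_ : PS → PS → PS
(f +ₚ g) n = f n xor g n

0ₚ : PS
0ₚ _ = false

*ₚ-as-Σ² : ∀ f g {n N} → n ≤ N → (f *ₚ g) n ≡ Σ≤ N (λ i → Σ≤ N (λ j → (f i ∧ g j) ∧ (i + j ≡ᵇ n)))
*ₚ-as-Σ² f g {n} {N} n≤N = sym (begin
  Σ≤ N (λ i → Σ≤ N (λ j → (f i ∧ g j) ∧ (i + j ≡ᵇ n))) ≡⟨ Σ≤-extend n≤N (λ i → row-beyond) ⟩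
  Σ≤ n (λ i → Σ≤ N (λ j → (f i ∧ g j) ∧ (i + j ≡ᵇ n))) ≡⟨ Σ≤-cong≤ n (λ i → row) ⟩
  (f *ₚ g) n                                           ∎)
  where
  row : ∀ {i} → i ≤ n → Σ≤ N (λ j → (f i ∧ g j) ∧ (i + j ≡ᵇ n)) ≡ f i ∧ g (n ∸ i)
  row {i} i≤n = trans (Σ≤-cong N (λ j → cong ((f i ∧ g j) ∧_) (+≡ᵇ⇔≡ᵇ∸ j i≤n)))
                      (Σ≤-select N (n ∸ i) (λ j → f i ∧ g j) (λ N<n∸i → contradiction (≤-trans (m∸n≤m n i) n≤N) (<⇒≱ N<n∸i)))
  row-beyond : ∀ {i} → n < i → Σ≤ N (λ j → (f i ∧ g j) ∧ (i + j ≡ᵇ n)) ≡ false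
  row-beyond {i} n<i = Σ≤-zero N (λ j _ → trans (cong ((f i ∧ g j) ∧_) (>⇒+≡ᵇ-false j n<i)) (∧-zeroʳ _))

Σ≤-convolution : ∀ f g n (c : ℕ → Bool) → (∀ m → n < m → c m ≡ false) →
                 Σ≤ n (λ m → (f *ₚ g) m ∧ c m) ≡ Σ≤ n (λ i → Σ≤ n (λ j → (f i ∧ g j) ∧ c (i + j)))
Σ≤-convolution f g n c c-beyond = begin
  Σ≤ n (λ m → (f *ₚ g) m ∧ c m)
    ≡⟨ Σ≤-cong≤ n (λ m m≤n → cong (_∧ c m) (*ₚ-as-Σ² f g m≤n)) ⟩
  Σ≤ n (λ m → Σ≤ n (λ i → Σ≤ n (λ j → (f i ∧ g j) ∧ (i + j ≡ᵇ m))) ∧ c m)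
    ≡⟨ Σ≤-cong n (λ m → Σ²-∧ʳ n _ (c m)) ⟩
  Σ≤ n (λ m → Σ≤ n (λ i → Σ≤ n (λ j → ((f i ∧ g j) ∧ (i + j ≡ᵇ m)) ∧ c m)))
    ≡⟨ trans (Σ≤-swap n n _) (Σ≤-cong n (λ i → Σ≤-swap n n _)) ⟩
  Σ≤ n (λ i → Σ≤ n (λ j → Σ≤ n (λ m → ((f i ∧ g j) ∧ (i + j ≡ᵇ m)) ∧ c m)))
    ≡⟨ Σ≤-cong n (λ i → Σ≤-cong n (λ j → trans (Σ≤-cong n (λ m → indicator-last (f i ∧ g j) i j m)) (select i j))) ⟩
  Σ≤ n (λ i → Σ≤ n (λ j → (f i ∧ g j) ∧ c (i + j)))
    ∎
  where
  indicator-last : ∀ x i j m → (x ∧ (i + j ≡ᵇ m)) ∧ c m ≡ (x ∧ c m) ∧ (m ≡ᵇ i + j)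
  indicator-last x i j m = trans (∧-swapʳ x (i + j ≡ᵇ m) (c m)) (cong ((x ∧ c m) ∧_) (≡ᵇ-sym (i + j) m))
  select : ∀ i j → Σ≤ n (λ m → ((f i ∧ g j) ∧ c m) ∧ (m ≡ᵇ i + j)) ≡ (f i ∧ g j) ∧ c (i + j)
  select i j = Σ≤-select n (i + j) (λ m → (f i ∧ g j) ∧ c m)
                 (λ n<i+j → trans (cong ((f i ∧ g j) ∧_) (c-beyond (i + j) n<i+j)) (∧-zeroʳ _))

*ₚ-comm : ∀ f g → (f *ₚ g) ≈ₚ (g *ₚ f)
*ₚ-comm f g n = begin
  (f *ₚ g) n                                           ≡⟨ *ₚ-as-Σ² f g (≤-refl {n}) ⟩
  Σ≤ n (λ i → Σ≤ n (λ j → (f i ∧ g j) ∧ (i + j ≡ᵇ n))) ≡⟨ Σ≤-swap n n _ ⟩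
  Σ≤ n (λ j → Σ≤ n (λ i → (f i ∧ g j) ∧ (i + j ≡ᵇ n))) ≡⟨ Σ≤-cong n (λ j → Σ≤-cong n (λ i →
                                                          cong₂ _∧_ (∧-comm (f i) (g j)) (cong (_≡ᵇ n) (+-comm i j)))) ⟩
  Σ≤ n (λ j → Σ≤ n (λ i → (g j ∧ f i) ∧ (j + i ≡ᵇ n))) ≡⟨ *ₚ-as-Σ² g f (≤-refl {n}) ⟨
  (g *ₚ f) n                                           ∎

*ₚ-as-Σ³ : ∀ f g h n → ((f *ₚ g) *ₚ h) n ≡
          Σ≤ n (λ k → Σ≤ n (λ i → Σ≤ n (λ j → (f i ∧ g j) ∧ (h k ∧ (i + j + k ≡ᵇ n)))))
*ₚ-as-Σ³ f g h n = begin
  ((f *ₚ g) *ₚ h) n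
    ≡⟨ *ₚ-as-Σ² (f *ₚ g) h (≤-refl {n}) ⟩
  Σ≤ n (λ m → Σ≤ n (λ k → ((f *ₚ g) m ∧ h k) ∧ (m + k ≡ᵇ n)))
    ≡⟨ Σ≤-swap n n _ ⟩
  Σ≤ n (λ k → Σ≤ n (λ m → ((f *ₚ g) m ∧ h k) ∧ (m + k ≡ᵇ n)))
    ≡⟨ Σ≤-cong n (λ k → Σ≤-cong n (λ m → ∧-assoc ((f *ₚ g) m) (h k) (m + k ≡ᵇ n))) ⟩
  Σ≤ n (λ k → Σ≤ n (λ m → (f *ₚ g) m ∧ (h k ∧ (m + k ≡ᵇ n))))
    ≡⟨ Σ≤-cong n (λ k → Σ≤-convolution f g n (λ m → h k ∧ (m + k ≡ᵇ n))
                          (λ m n<m → trans (cong (h k ∧_) (>⇒+≡ᵇ-false k n<m)) (∧-zeroʳ (h k)))) ⟩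
  Σ≤ n (λ k → Σ≤ n (λ i → Σ≤ n (λ j → (f i ∧ g j) ∧ (h k ∧ (i + j + k ≡ᵇ n)))))
    ∎

*ₚ-assoc : ∀ f g h → ((f *ₚ g) *ₚ h) ≈ₚ (f *ₚ (g *ₚ h))
*ₚ-assoc f g h n = begin
  ((f *ₚ g) *ₚ h) n
    ≡⟨ *ₚ-as-Σ³ f g h n ⟩
  Σ≤ n (λ k → Σ≤ n (λ i → Σ≤ n (λ j → (f i ∧ g j) ∧ (h k ∧ (i + j + k ≡ᵇ n)))))
    ≡⟨ trans (Σ≤-swap n n _) (Σ≤-cong n (λ i → Σ≤-swap n n _)) ⟩
  Σ≤ n (λ i → Σ≤ n (λ j → Σ≤ n (λ k → (f i ∧ g j) ∧ (h k ∧ (i + j + k ≡ᵇ n)))))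
    ≡⟨ Σ≤-cong n (λ i → Σ≤-cong n (λ j → Σ≤-cong n (λ k → rotate i j k))) ⟩
  Σ≤ n (λ i → Σ≤ n (λ j → Σ≤ n (λ k → (g j ∧ h k) ∧ (f i ∧ (j + k + i ≡ᵇ n)))))
    ≡⟨ *ₚ-as-Σ³ g h f n ⟨
  ((g *ₚ h) *ₚ f) n
    ≡⟨ *ₚ-comm (g *ₚ h) f n ⟩
  (f *ₚ (g *ₚ h)) n
    ∎
  where
  rotate : ∀ i j k → (f i ∧ g j) ∧ (h k ∧ (i + j + k ≡ᵇ n)) ≡ (g j ∧ h k) ∧ (f i ∧ (j + k + i ≡ᵇ n))
  rotate i j k rewrite +-assoc i j k | +-comm i (j + k) = ∧-rotate (f i) (g j) (h k) (j + k + i ≡ᵇ n)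
    where
    ∧-rotate : ∀ a b c d → (a ∧ b) ∧ (c ∧ d) ≡ (b ∧ c) ∧ (a ∧ d)
    ∧-rotate = solve 4 (λ a b c d → (a :* b) :* (c :* d) := (b :* c) :* (a :* d)) refl
      where open xor-∧-Solver

*ₚ-identityˡ : ∀ f → (oneₚ *ₚ f) ≈ₚ f
*ₚ-identityˡ f n = Σ≤-point n 0 z≤n (λ i _ i≢0 → cong (_∧ f (n ∸ i)) (≢⇒≡ᵇ-false i≢0))

*ₚ-zeroˡ : ∀ f → (0ₚ *ₚ f) ≈ₚ 0ₚ
*ₚ-zeroˡ f n = Σ≤-zero n (λ _ _ → refl)

*ₚ-distribʳ : ∀ f g h → ((g +ₚ h) *ₚ f) ≈ₚ ((g *ₚ f) +ₚ (h *ₚ f))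
*ₚ-distribʳ f g h n = trans (Σ≤-cong n (λ i → ∧-distribʳ-xor (f (n ∸ i)) (g i) (h i))) (Σ≤-xor n _ _)

*ₚ-cong : ∀ {f f′ g g′} → f ≈ₚ f′ → g ≈ₚ g′ → (f *ₚ g) ≈ₚ (f′ *ₚ g′)
*ₚ-cong f≈f′ g≈g′ n = Σ≤-cong n (λ i → cong₂ _∧_ (f≈f′ i) (g≈g′ (n ∸ i)))

*ₚ-cong≤ : ∀ {f f′ g g′ n} → (∀ m → m ≤ n → f m ≡ f′ m) → (∀ m → m ≤ n → g m ≡ g′ m) → (f *ₚ g) n ≡ (f′ *ₚ g′) n
*ₚ-cong≤ {n = n} f≡f′ g≡g′ = Σ≤-cong≤ n (λ i i≤n → cong₂ _∧_ (f≡f′ i i≤n) (g≡g′ (n ∸ i) (m∸n≤m n i)))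

*ₚ-bilinear : ∀ N (a b : ℕ → Bool) (u v : ℕ → PS) n →
              ((λ m → Σ≤ N (λ i → a i ∧ u i m)) *ₚ (λ m → Σ≤ N (λ j → b j ∧ v j m))) n
              ≡ Σ≤ N (λ i → Σ≤ N (λ j → (a i ∧ b j) ∧ (u i *ₚ v j) n))
*ₚ-bilinear N a b u v n = begin
  Σ≤ n (λ p → Σ≤ N (λ i → a i ∧ u i p) ∧ Σ≤ N (λ j → b j ∧ v j (n ∸ p)))
    ≡⟨ Σ≤-cong n (λ p → Σ≤-∧-Σ≤ N N _ _) ⟩
  Σ≤ n (λ p → Σ≤ N (λ i → Σ≤ N (λ j → (a i ∧ u i p) ∧ (b j ∧ v j (n ∸ p)))))
    ≡⟨ trans (Σ≤-swap n N _) (Σ≤-cong N (λ i → Σ≤-swap n N _)) ⟩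
  Σ≤ N (λ i → Σ≤ N (λ j → Σ≤ n (λ p → (a i ∧ u i p) ∧ (b j ∧ v j (n ∸ p)))))
    ≡⟨ Σ≤-cong N (λ i → Σ≤-cong N (λ j → trans (Σ≤-cong n (λ p → ∧-interchange (a i) (u i p) (b j) (v j (n ∸ p))))
                                               (sym (Σ≤-∧ˡ n (a i ∧ b j) _)))) ⟩
  Σ≤ N (λ i → Σ≤ N (λ j → (a i ∧ b j) ∧ (u i *ₚ v j) n))
    ∎

+ₚ-isCommutativeMonoid : IsCommutativeMonoid _≈ₚ_ _+ₚ_ 0ₚ
+ₚ-isCommutativeMonoid = Pointwise.isCommutativeMonoid ℕ (CommutativeRing.+-isCommutativeMonoid xor-∧-commutativeRing)

open IsCommutativeMonoid +ₚ-isCommutativeMonoid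
  using () renaming (refl to ≈ₚ-refl; sym to ≈ₚ-sym; trans to ≈ₚ-trans; ∙-cong to +ₚ-cong)

PS-commutativeSemiring : CommutativeSemiring 0ℓ 0ℓ
PS-commutativeSemiring = record
  { Carrier = PS ; _≈_ = _≈ₚ_ ; _+_ = _+ₚ_ ; _*_ = _*ₚ_ ; 0# = 0ₚ ; 1# = oneₚ
  ; isCommutativeSemiring = Biased.isCommutativeSemiringˡ record
    { +-isCommutativeMonoid = +ₚ-isCommutativeMonoid
    ; *-isCommutativeMonoid = Biased.isCommutativeMonoidˡ record
      { isSemigroup = record
        { isMagma = record { isEquivalence = IsCommutativeMonoid.isEquivalence +ₚ-isCommutativeMonoid ; ∙-cong = *ₚ-cong }
        ; assoc   = *ₚ-assoc }
      ; identityˡ = *ₚ-identityˡ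
      ; comm      = *ₚ-comm }
    ; distribʳ = *ₚ-distribʳ
    ; zeroˡ    = *ₚ-zeroˡ } }

open CommutativeSemiring PS-commutativeSemiring using () renaming (zeroʳ to *ₚ-zeroʳ; *-identityʳ to *ₚ-identityʳ)

PS-almostCommutativeRing : AlmostCommutativeRing 0ℓ 0ℓ
PS-almostCommutativeRing = fromCommutativeSemiring PS-commutativeSemiring

constₚ : Bool → PS
constₚ true  = oneₚ
constₚ false = 0ₚ

𝔽₂ : RawRing 0ℓ 0ℓ
𝔽₂ = CommutativeRing.rawRing xor-∧-commutativeRing

constₚ-homomorphism : 𝔽₂ -Raw-AlmostCommutative⟶ PS-almostCommutativeRing
constₚ-homomorphism = record
  { ⟦_⟧    = constₚ
  ; +-homo = +-homo
  ; *-homo = *-homo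
  ; -‿homo = λ _ → ≈ₚ-refl
  ; 0-homo = ≈ₚ-refl
  ; 1-homo = ≈ₚ-refl }
  where
  +-homo : ∀ a b → constₚ (a xor b) ≈ₚ (constₚ a +ₚ constₚ b)
  +-homo true  true  n = sym (xor-same (oneₚ n))
  +-homo true  false n = sym (xor-identityʳ (oneₚ n))
  +-homo false b     n = refl
  *-homo : ∀ a b → constₚ (a ∧ b) ≈ₚ (constₚ a *ₚ constₚ b)
  *-homo true  b = ≈ₚ-sym (*ₚ-identityˡ (constₚ b))
  *-homo false b = ≈ₚ-sym (*ₚ-zeroˡ (constₚ b))

constₚ-≟ : ∀ a b → Maybe (constₚ a ≈ₚ constₚ b)
constₚ-≟ a b with a ≟ᵇ b
... | yes refl = just ≈ₚ-refl
... | no _     = nothing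

-- Normal forms have coefficients in 𝔽₂, so the solver knows that p + p = 0.
open import Algebra.Solver.Ring 𝔽₂ PS-almostCommutativeRing constₚ-homomorphism constₚ-≟
  using (Polynomial; op; [+]; [*]; con; var; _:^_; :-_; _:+_; _:*_; ⟦_⟧; ⟦_⟧↓; prove)

open SemiringMorphisms (CommutativeSemiring.rawSemiring PS-commutativeSemiring)
                       (CommutativeSemiring.rawSemiring PS-commutativeSemiring)
  using (IsSemiringHomomorphism)

*ₚ-vanishesʳ : ∀ f {g} → g ≈ₚ 0ₚ → (f *ₚ g) ≈ₚ 0ₚ
*ₚ-vanishesʳ f g≈0 = ≈ₚ-trans (*ₚ-cong ≈ₚ-refl g≈0) (*ₚ-zeroʳ f)

*ₚ-vanishesˡ : ∀ {f} g → f ≈ₚ 0ₚ → (f *ₚ g) ≈ₚ 0ₚ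
*ₚ-vanishesˡ g f≈0 = ≈ₚ-trans (*ₚ-cong {g = g} {g′ = g} f≈0 ≈ₚ-refl) (*ₚ-zeroˡ g)

+ₚ-vanishes : ∀ {f g} → f ≈ₚ 0ₚ → g ≈ₚ 0ₚ → (f +ₚ g) ≈ₚ 0ₚ
+ₚ-vanishes f≈0 g≈0 n = cong₂ _xor_ (f≈0 n) (g≈0 n)

≈ₚ⇒+ₚ-vanishes : ∀ {f g} → f ≈ₚ g → (f +ₚ g) ≈ₚ 0ₚ
≈ₚ⇒+ₚ-vanishes {f} f≈g n = trans (cong (f n xor_) (sym (f≈g n))) (xor-same (f n))

+ₚ-vanishes⇒≈ₚ : ∀ {f g} → (f +ₚ g) ≈ₚ 0ₚ → f ≈ₚ g
+ₚ-vanishes⇒≈ₚ {f} {g} f+g≈0 n = xor≡false⇒≡ (f+g≈0 n)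
  where
  xor≡false⇒≡ : ∀ {x y} → x xor y ≡ false → x ≡ y
  xor≡false⇒≡ {false} {false} _  = refl
  xor≡false⇒≡ {false} {true}  ()
  xor≡false⇒≡ {true}  {false} ()
  xor≡false⇒≡ {true}  {true}  _  = refl

HasValuation : PS → ℕ → Set
HasValuation g k = (∀ i → i < k → g i ≡ false) × g k ≡ true

*ₚ-cancelʳ-vanishes : ∀ {f} g {k} → HasValuation g k → (f *ₚ g) ≈ₚ 0ₚ → f ≈ₚ 0ₚ
*ₚ-cancelʳ-vanishes {f} g {k} (g<k≡0 , gk≡1) fg≈0 = <-rec (λ m → f m ≡ false) step
  where
  step : ∀ m → (∀ {i} → i < m → f i ≡ false) → f m ≡ false
  step m f<m≡0 = begin
    f m                  ≡⟨ ∧-identityʳ (f m) ⟨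
    f m ∧ true           ≡⟨ cong (f m ∧_) (trans (sym gk≡1) (cong g (sym (m+n∸m≡n m k)))) ⟩
    f m ∧ g (m + k ∸ m)  ≡⟨ Σ≤-point (m + k) m (m≤m+n m k) other-terms ⟨
    (f *ₚ g) (m + k)     ≡⟨ fg≈0 (m + k) ⟩
    false                ∎
    where
    other-terms : ∀ i → i ≤ m + k → i ≢ m → f i ∧ g (m + k ∸ i) ≡ false
    other-terms i i≤m+k i≢m with <-cmp i m
    ... | tri< i<m _ _ = cong (_∧ g (m + k ∸ i)) (f<m≡0 i<m)
    ... | tri≈ _ i≡m _ = contradiction i≡m i≢m
    ... | tri> _ _ m<i = trans (cong (f i ∧_) (g<k≡0 (m + k ∸ i) m+k∸i<k)) (∧-zeroʳ (f i))
      where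
      m+k∸i<k : m + k ∸ i < k
      m+k∸i<k = subst (m + k ∸ i <_) (m+n∸m≡n m k) (∸-monoʳ-< m<i i≤m+k)

-- Certificates of ideal membership: p vanishes at ρ as a combination of relations known to vanish there.
record VanishesAt {m} (ρ : Vec PS m) (p : Polynomial m) : Set where
  constructor vanishesAt
  field vanishes : ⟦ p ⟧ ρ ≈ₚ 0ₚ
open VanishesAt

module _ {m} {ρ : Vec PS m} where
  infixl 7 _⊕_
  infixr 8 _⊛_
  infixl 10 _^⁺_

  _⊕_ : ∀ {p q} → VanishesAt ρ p → VanishesAt ρ q → VanishesAt ρ (p :+ q)
  vanishesAt p≈0 ⊕ vanishesAt q≈0 = vanishesAt (+ₚ-vanishes p≈0 q≈0)

  _⊛_ : ∀ c {p} → VanishesAt ρ p → VanishesAt ρ (c :* p)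
  c ⊛ vanishesAt p≈0 = vanishesAt (*ₚ-vanishesʳ (⟦ c ⟧ ρ) p≈0)

  _^⁺_ : ∀ {p} → VanishesAt ρ p → ∀ k .{{_ : NonZero k}} → VanishesAt ρ (p :^ k)
  _^⁺_ {p} (vanishesAt p≈0) (suc k) = vanishesAt (*ₚ-vanishesˡ (⟦ p :^ k ⟧ ρ) p≈0)

  by-certificate : ∀ {p q} → ⟦ p ⟧↓ ρ ≈ₚ ⟦ q ⟧↓ ρ → VanishesAt ρ q → VanishesAt ρ p
  by-certificate {p} {q} p≈q (vanishesAt q≈0) = vanishesAt (≈ₚ-trans (prove ρ p q p≈q) q≈0)

  cancel-valuation : ∀ {p} g {k} → HasValuation (⟦ g ⟧ ρ) k → VanishesAt ρ (p :* g) → VanishesAt ρ p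
  cancel-valuation g g-valuation (vanishesAt pg≈0) = vanishesAt (*ₚ-cancelʳ-vanishes (⟦ g ⟧ ρ) g-valuation pg≈0)

-- Semiring endomorphisms: constant term and substitution for t

mkIsSemiringHomomorphism : ∀ {φ : PS → PS} →
  (∀ {f g} → f ≈ₚ g → φ f ≈ₚ φ g) →
  (∀ f g → φ (f +ₚ g) ≈ₚ (φ f +ₚ φ g)) → (∀ f g → φ (f *ₚ g) ≈ₚ (φ f *ₚ φ g)) →
  φ 0ₚ ≈ₚ 0ₚ → φ oneₚ ≈ₚ oneₚ → IsSemiringHomomorphism φ
mkIsSemiringHomomorphism φ-cong φ-+ φ-* φ-0 φ-1 = record
  { isNearSemiringHomomorphism = record
    { +-isMonoidHomomorphism = record
      { isMagmaHomomorphism = record { isRelHomomorphism = record { cong = φ-cong } ; homo = φ-+ }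
      ; ε-homo = φ-0 }
    ; *-homo = φ-* }
  ; 1#-homo = φ-1 }

module _ {φ : PS → PS} (φ-homomorphism : IsSemiringHomomorphism φ) where
  open IsSemiringHomomorphism φ-homomorphism

  ⟦⟧-homomorphic : ∀ {m} (p : Polynomial m) {ρ ρ′ : Vec PS m} →
                   (∀ i → lookup ρ′ i ≈ₚ φ (lookup ρ i)) → φ (⟦ p ⟧ ρ) ≈ₚ ⟦ p ⟧ ρ′
  :^-homomorphic : ∀ {m} (p : Polynomial m) k {ρ ρ′ : Vec PS m} →
                   (∀ i → lookup ρ′ i ≈ₚ φ (lookup ρ i)) → φ (⟦ p :^ k ⟧ ρ) ≈ₚ ⟦ p :^ k ⟧ ρ′
  ⟦⟧-homomorphic (op [+] p q) ρ′≈φρ = ≈ₚ-trans (+-homo _ _) (+ₚ-cong (⟦⟧-homomorphic p ρ′≈φρ) (⟦⟧-homomorphic q ρ′≈φρ))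
  ⟦⟧-homomorphic (op [*] p q) ρ′≈φρ = ≈ₚ-trans (*-homo _ _) (*ₚ-cong (⟦⟧-homomorphic p ρ′≈φρ) (⟦⟧-homomorphic q ρ′≈φρ))
  ⟦⟧-homomorphic (con true)   ρ′≈φρ = 1#-homo
  ⟦⟧-homomorphic (con false)  ρ′≈φρ = 0#-homo
  ⟦⟧-homomorphic (var i)      ρ′≈φρ = ≈ₚ-sym (ρ′≈φρ i)
  ⟦⟧-homomorphic (p :^ k)     ρ′≈φρ = :^-homomorphic p k ρ′≈φρ
  ⟦⟧-homomorphic (:- p)       ρ′≈φρ = ⟦⟧-homomorphic p ρ′≈φρ
  :^-homomorphic p zero    ρ′≈φρ = 1#-homo
  :^-homomorphic p (suc k) ρ′≈φρ = ≈ₚ-trans (*-homo _ _) (*ₚ-cong (⟦⟧-homomorphic p ρ′≈φρ) (:^-homomorphic p k ρ′≈φρ))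

constantTermₚ : PS → PS
constantTermₚ f = constₚ (f 0)

constantTermₚ-isSemiringHomomorphism : IsSemiringHomomorphism constantTermₚ
constantTermₚ-isSemiringHomomorphism = mkIsSemiringHomomorphism
  (λ f≈g n → cong (λ b → constₚ b n) (f≈g 0))
  (λ f g → +-homo (f 0) (g 0)) (λ f g → *-homo (f 0) (g 0)) ≈ₚ-refl ≈ₚ-refl
  where open _-Raw-AlmostCommutative⟶_ constₚ-homomorphism

⟦⟧-constant-term : ∀ {m} (p : Polynomial m) {ρ : Vec PS m} →
                   (∀ i → lookup ρ i 0 ≡ false) → ⟦ p ⟧ ρ 0 ≡ ⟦ p ⟧ (replicate m 0ₚ) 0
⟦⟧-constant-term p {ρ} ρ₀≡0 = trans (sym (constₚ-0 (⟦ p ⟧ ρ 0)))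
  (⟦⟧-homomorphic constantTermₚ-isSemiringHomomorphism p
     (λ i n → trans (cong (λ h → h n) (lookup-replicate i 0ₚ)) (cong (λ b → constₚ b n) (sym (ρ₀≡0 i)))) 0)
  where
  constₚ-0 : ∀ b → constₚ b 0 ≡ b
  constₚ-0 true  = refl
  constₚ-0 false = refl

module Composition (τ : PS) (τ₀≡0 : τ 0 ≡ false) where

  ^ₚ-valuation : ∀ k {n} → n < k → (τ ^ₚ k) n ≡ false
  ^ₚ-valuation (suc k) {n} n<1+k = Σ≤-zero n term
    where
    term : ∀ i → i ≤ n → τ i ∧ (τ ^ₚ k) (n ∸ i) ≡ false
    term zero    _     = cong (_∧ (τ ^ₚ k) n) τ₀≡0
    term (suc i) 1+i≤n = trans (cong (τ (suc i) ∧_)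
      (^ₚ-valuation k (<-≤-trans (∸-monoʳ-< {n} {suc i} {0} (s≤s z≤n) 1+i≤n) (≤-pred n<1+k)))) (∧-zeroʳ _)

  ∘ₚ-as-Σ : ∀ f {n N} → n ≤ N → (f ∘ₚ τ) n ≡ Σ≤ N (λ k → f k ∧ (τ ^ₚ k) n)
  ∘ₚ-as-Σ f n≤N = sym (Σ≤-extend n≤N (λ k n<k → trans (cong (f k ∧_) (^ₚ-valuation k n<k)) (∧-zeroʳ (f k))))

  ^ₚ-+ : ∀ i j → (τ ^ₚ (i + j)) ≈ₚ ((τ ^ₚ i) *ₚ (τ ^ₚ j))
  ^ₚ-+ zero    j = ≈ₚ-sym (*ₚ-identityˡ (τ ^ₚ j))
  ^ₚ-+ (suc i) j = ≈ₚ-trans (*ₚ-cong ≈ₚ-refl (^ₚ-+ i j)) (≈ₚ-sym (*ₚ-assoc τ (τ ^ₚ i) (τ ^ₚ j)))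

  ∘ₚ-* : ∀ f g → ((f *ₚ g) ∘ₚ τ) ≈ₚ ((f ∘ₚ τ) *ₚ (g ∘ₚ τ))
  ∘ₚ-* f g n = begin
    ((f *ₚ g) ∘ₚ τ) n
      ≡⟨ Σ≤-convolution f g n (λ k → (τ ^ₚ k) n) (λ k n<k → ^ₚ-valuation k n<k) ⟩
    Σ≤ n (λ i → Σ≤ n (λ j → (f i ∧ g j) ∧ (τ ^ₚ (i + j)) n))
      ≡⟨ Σ≤-cong n (λ i → Σ≤-cong n (λ j → cong ((f i ∧ g j) ∧_) (^ₚ-+ i j n))) ⟩
    Σ≤ n (λ i → Σ≤ n (λ j → (f i ∧ g j) ∧ ((τ ^ₚ i) *ₚ (τ ^ₚ j)) n))
      ≡⟨ *ₚ-bilinear n f g (τ ^ₚ_) (τ ^ₚ_) n ⟨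
    (truncation f *ₚ truncation g) n
      ≡⟨ *ₚ-cong≤ {n = n} (λ m m≤n → ∘ₚ-as-Σ f m≤n) (λ m m≤n → ∘ₚ-as-Σ g m≤n) ⟨
    ((f ∘ₚ τ) *ₚ (g ∘ₚ τ)) n
      ∎
    where
    truncation : PS → PS
    truncation h m = Σ≤ n (λ k → h k ∧ (τ ^ₚ k) m)

  ∘ₚ-isSemiringHomomorphism : IsSemiringHomomorphism (_∘ₚ τ)
  ∘ₚ-isSemiringHomomorphism = mkIsSemiringHomomorphism
    (λ f≈g n → Σ≤-cong n (λ k → cong (_∧ (τ ^ₚ k) n) (f≈g k)))
    (λ f g n → trans (Σ≤-cong n (λ k → ∧-distribʳ-xor ((τ ^ₚ k) n) (f k) (g k))) (Σ≤-xor n _ _))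
    ∘ₚ-*
    (λ n → Σ≤-zero n (λ _ _ → refl))
    (λ n → Σ≤-point n 0 z≤n (λ k _ k≢0 → cong (_∧ (τ ^ₚ k) n) (≢⇒≡ᵇ-false k≢0)))

  tₚ-∘ₚ : (tₚ ∘ₚ τ) ≈ₚ τ
  tₚ-∘ₚ zero    = sym τ₀≡0
  tₚ-∘ₚ (suc n) = trans (Σ≤-point (suc n) 1 (s≤s z≤n) (λ k _ k≢1 → cong (_∧ (τ ^ₚ k) (suc n)) (≢⇒≡ᵇ-false k≢1)))
                        (*ₚ-identityʳ τ (suc n))

VanishesAt-∘ₚ : ∀ τ → τ 0 ≡ false → ∀ {m} {p : Polynomial m} {ρ ρ′ : Vec PS m} →
                (∀ i → lookup ρ′ i ≈ₚ (lookup ρ i ∘ₚ τ)) → VanishesAt ρ p → VanishesAt ρ′ p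
VanishesAt-∘ₚ τ τ₀≡0 {p = p} ρ′≈ρ∘τ (vanishesAt p≈0) = vanishesAt
  (≈ₚ-trans (≈ₚ-sym (⟦⟧-homomorphic ∘ₚ-isSemiringHomomorphism p ρ′≈ρ∘τ)) (≈ₚ-trans (⟦⟧-cong p≈0) 0#-homo))
  where
  open Composition τ τ₀≡0 using (∘ₚ-isSemiringHomomorphism)
  open IsSemiringHomomorphism ∘ₚ-isSemiringHomomorphism using (⟦⟧-cong; 0#-homo)

-- The automaton and its Mahler equations

isOdd-double : ∀ m → isOdd (m + m) ≡ false
isOdd-double zero    = refl
isOdd-double (suc m) rewrite +-suc m m = isOdd-double m

isOdd-suc-double : ∀ m → isOdd (suc (m + m)) ≡ true
isOdd-suc-double zero    = refl
isOdd-suc-double (suc m) rewrite +-suc m m = isOdd-suc-double m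

double-injective : ∀ {i m} → i + i ≡ m + m → i ≡ m
double-injective {i} {m} 2i≡2m = trans (n≡⌊n+n/2⌋ i) (trans (cong ⌊_/2⌋ 2i≡2m) (sym (n≡⌊n+n/2⌋ m)))

double≢suc-double : ∀ i m → i + i ≢ suc (m + m)
double≢suc-double i m 2i≡2m+1 =
  contradiction (trans (sym (isOdd-double i)) (trans (cong isOdd 2i≡2m+1) (isOdd-suc-double m))) (λ ())

even-or-odd : ∀ n → ∃[ m ] (n ≡ m + m ⊎ n ≡ suc (m + m))
even-or-odd zero = 0 , inj₁ refl
even-or-odd (suc n) with even-or-odd n
... | m , inj₁ n≡2m   = m , inj₂ (cong suc n≡2m)
... | m , inj₂ n≡2m+1 = suc m , inj₁ (trans (cong suc n≡2m+1) (cong suc (sym (+-suc m m))))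

^ₚ-2 : ∀ g → (g ^ₚ 2) ≈ₚ (g *ₚ g)
^ₚ-2 g = *ₚ-cong ≈ₚ-refl (*ₚ-identityʳ g)

^ₚ-2-as-Σ : ∀ g n → (g ^ₚ 2) n ≡ Σ≤ n (λ i → g i ∧ (i + i ≡ᵇ n))
^ₚ-2-as-Σ g n = begin
  (g ^ₚ 2) n                                            ≡⟨ ^ₚ-2 g n ⟩
  (g *ₚ g) n                                            ≡⟨ *ₚ-as-Σ² g g (≤-refl {n}) ⟩
  Σ≤ n (λ i → Σ≤ n (λ j → (g i ∧ g j) ∧ (i + j ≡ᵇ n))) ≡⟨ Σ≤-diagonal n _ (λ i j →
                                                           cong₂ _∧_ (∧-comm (g i) (g j)) (cong (_≡ᵇ n) (+-comm i j))) ⟩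
  Σ≤ n (λ i → (g i ∧ g i) ∧ (i + i ≡ᵇ n))               ≡⟨ Σ≤-cong n (λ i → cong (_∧ (i + i ≡ᵇ n)) (∧-idem (g i))) ⟩
  Σ≤ n (λ i → g i ∧ (i + i ≡ᵇ n))                       ∎

^ₚ-2-even : ∀ g m → (g ^ₚ 2) (m + m) ≡ g m
^ₚ-2-even g m = trans (^ₚ-2-as-Σ g (m + m)) (trans (Σ≤-point (m + m) m (m≤m+n m m) other-terms)
                                                   (trans (cong (g m ∧_) (≡ᵇ-refl (m + m))) (∧-identityʳ (g m))))
  where
  other-terms : ∀ i → i ≤ m + m → i ≢ m → g i ∧ (i + i ≡ᵇ m + m) ≡ false
  other-terms i _ i≢m = trans (cong (g i ∧_) (≢⇒≡ᵇ-false (i≢m ∘ double-injective))) (∧-zeroʳ (g i))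

^ₚ-2-odd : ∀ g m → (g ^ₚ 2) (suc (m + m)) ≡ false
^ₚ-2-odd g m = trans (^ₚ-2-as-Σ g (suc (m + m))) (Σ≤-zero (suc (m + m)) (λ i _ →
  trans (cong (g i ∧_) (≢⇒≡ᵇ-false (double≢suc-double i m))) (∧-zeroʳ (g i))))

tₚ-*ₚ-suc : ∀ h n → (tₚ *ₚ h) (suc n) ≡ h n
tₚ-*ₚ-suc h n = Σ≤-point (suc n) 1 (s≤s z≤n) (λ i _ i≢1 → cong (_∧ h (suc n ∸ i)) (≢⇒≡ᵇ-false i≢1))

square-+-t*square-even : ∀ g h m → ((g ^ₚ 2) +ₚ (tₚ *ₚ (h ^ₚ 2))) (m + m) ≡ g m
square-+-t*square-even g h m = trans (cong₂ _xor_ (^ₚ-2-even g m) (t*square-even m)) (xor-identityʳ (g m))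
  where
  t*square-even : ∀ m → (tₚ *ₚ (h ^ₚ 2)) (m + m) ≡ false
  t*square-even zero    = refl
  t*square-even (suc m) = trans (tₚ-*ₚ-suc (h ^ₚ 2) (m + suc m)) (trans (cong (h ^ₚ 2) (+-suc m m)) (^ₚ-2-odd h m))

square-+-t*square-odd : ∀ g h m → ((g ^ₚ 2) +ₚ (tₚ *ₚ (h ^ₚ 2))) (suc (m + m)) ≡ h m
square-+-t*square-odd g h m = cong₂ _xor_ (^ₚ-2-odd g m) (trans (tₚ-*ₚ-suc (h ^ₚ 2) (m + m)) (^ₚ-2-even h m))

runFuel-irrelevant : ∀ f g s k → k ≤ f → k ≤ g → runFuel f s k ≡ runFuel g s k
runFuel-irrelevant zero    zero    s k       _         _         = refl
runFuel-irrelevant zero    (suc g) s zero    _         _         = refl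
runFuel-irrelevant (suc f) zero    s zero    _         _         = refl
runFuel-irrelevant (suc f) (suc g) s zero    _         _         = refl
runFuel-irrelevant (suc f) (suc g) s (suc k) (s≤s k≤f) (s≤s k≤g) =
  runFuel-irrelevant f g _ ⌊ suc k /2⌋ (≤-trans half≤k k≤f) (≤-trans half≤k k≤g)
  where
  half≤k : ⌊ suc k /2⌋ ≤ k
  half≤k = ≤-pred (⌊n/2⌋<n k)

stateSeries : State → PS
stateSeries s k = label (runFuel k s k)

stateSeries-suc : ∀ s k → stateSeries s (suc k) ≡ stateSeries (δ s (isOdd (suc k))) ⌊ suc k /2⌋
stateSeries-suc s k = cong label (runFuel-irrelevant k ⌊ suc k /2⌋ _ ⌊ suc k /2⌋ (≤-pred (⌊n/2⌋<n k)) ≤-refl)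

-- Coefficient 0 reads the empty word, so a leading zero must not change the output.
label-δ-false : ∀ s → label (δ s false) ≡ label s
label-δ-false A = refl
label-δ-false B = refl
label-δ-false C = refl
label-δ-false D = refl
label-δ-false E = refl

stateSeries-even : ∀ s m → stateSeries s (m + m) ≡ stateSeries (δ s false) m
stateSeries-even s zero    = sym (label-δ-false s)
stateSeries-even s (suc m) = trans (stateSeries-suc s (m + suc m))
  (cong₂ (λ b → stateSeries (δ s b)) (isOdd-double (suc m)) (sym (n≡⌊n+n/2⌋ (suc m))))

stateSeries-odd : ∀ s m → stateSeries s (suc (m + m)) ≡ stateSeries (δ s true) m
stateSeries-odd s m = trans (stateSeries-suc s (m + m))
  (cong₂ (λ b → stateSeries (δ s b)) (isOdd-suc-double m) (sym (n≡⌈n+n/2⌉ m)))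

mahler-equation : ∀ s → stateSeries s ≈ₚ ((stateSeries (δ s false) ^ₚ 2) +ₚ (tₚ *ₚ (stateSeries (δ s true) ^ₚ 2)))
mahler-equation s n with even-or-odd n
... | m , inj₁ refl = trans (stateSeries-even s m)
                            (sym (square-+-t*square-even (stateSeries (δ s false)) (stateSeries (δ s true)) m))
... | m , inj₂ refl = trans (stateSeries-odd s m)
                            (sym (square-+-t*square-odd (stateSeries (δ s false)) (stateSeries (δ s true)) m))

-- The algebraic equation of σmin and its consequence for the iterates

1ᵖ : ∀ {n} → Polynomial n
1ᵖ = con true

-- σmin is a root of F t; L is the extra factor met when eliminating the other states.
-- H x z = 0 relates an iterate x to z = σmin ∘ σmin ∘ x, and H x y − H x z = (y − z) · W x y z.
F : ∀ {n} → Polynomial n → Polynomial n → Polynomial n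
F x y = y :* (1ᵖ :+ y) :^ 2 :+ x :* (1ᵖ :+ x) :^ 2 :* (1ᵖ :+ y) :^ 3 :+ x :^ 2 :* y :^ 3

L : ∀ {n} → Polynomial n → Polynomial n → Polynomial n
L x y = x :+ y :+ x :* y

H : ∀ {n} → Polynomial n → Polynomial n → Polynomial n
H x z = x :+ z :+ x :^ 2 :* z :^ 2 :+ x :^ 3 :* z :^ 3

W : ∀ {n} → Polynomial n → Polynomial n → Polynomial n → Polynomial n
W x y z = 1ᵖ :+ x :^ 2 :* (y :+ z) :+ x :^ 3 :* (y :^ 2 :+ y :* z :+ z :^ 2)

-- Cofactors eliminating y between F x y and F y z, found by a Gröbner basis computation.
H-cofactor F-cofactor₁ F-cofactor₂ : ∀ {n} → Polynomial n → Polynomial n → Polynomial n → Polynomial n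
H-cofactor x y z =
  1ᵖ :+ z :^ 2 :+ y :+ y :* z :+ y :^ 2 :+ y :^ 2 :* z :+ y :^ 3 :+ y :^ 4 :* z :^ 2 :+ x :* z :+ x :* z :^ 2
  :+ x :* y :* z :+ x :* y :^ 2 :+ x :* y :^ 2 :* z :+ x :* y :^ 4 :+ x :* y :^ 4 :* z :^ 2 :+ x :^ 2 :+ x :^ 2 :* z
  :+ x :^ 2 :* y :* z :+ x :^ 2 :* y :^ 2 :* z :+ x :^ 2 :* y :^ 3 :* z :+ x :^ 2 :* y :^ 4
F-cofactor₁ x y z =
  1ᵖ :+ z :^ 2 :+ z :^ 3 :+ z :^ 4 :+ y :* z :+ y :* z :^ 2 :+ y :* z :^ 3 :+ y :^ 2 :+ y :^ 2 :* z :^ 4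
  :+ x :* z :^ 2 :+ x :* z :^ 4 :+ x :* y :* z :^ 3 :+ x :* y :* z :^ 4 :+ x :^ 2 :* z :^ 3 :+ x :^ 2 :* z :^ 4
  :+ x :^ 2 :* y :* z :^ 3
F-cofactor₂ x y z =
  1ᵖ :+ y :* z :+ y :^ 2 :+ y :^ 2 :* z :+ x :* z :+ x :* y :+ x :* y :* z :+ x :* y :^ 2 :+ x :* y :^ 2 :* z
  :+ x :^ 2 :* y :+ x :^ 2 :* y :* z :+ x :^ 2 :* y :^ 2 :+ x :^ 2 :* y :^ 2 :* z :+ x :^ 3 :+ x :^ 3 :* z
  :+ x :^ 3 :* z :^ 2 :+ x :^ 3 :* y :* z :+ x :^ 3 :* y :* z :^ 2 :+ x :^ 3 :* y :^ 2 :+ x :^ 3 :* y :^ 2 :* z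
  :+ x :^ 4 :* z :^ 2 :+ x :^ 4 :* y :* z :^ 2

x̂ : ∀ {n} → Polynomial (1 + n)
x̂ = var (# 0)

ŷ : ∀ {n} → Polynomial (2 + n)
ŷ = var (# 1)

ẑ : ∀ {n} → Polynomial (3 + n)
ẑ = var (# 2)

t̂ â b̂ ĉ d̂ ê : Polynomial 6
t̂ = var (# 0)
â = var (# 1)
b̂ = var (# 2)
ĉ = var (# 3)
d̂ = var (# 4)
ê = var (# 5)

stateVar : State → Polynomial 6
stateVar A = â
stateVar B = b̂
stateVar C = ĉ
stateVar D = d̂
stateVar E = ê

ρ₆ : Vec PS 6
ρ₆ = tₚ ∷ stateSeries A ∷ stateSeries B ∷ stateSeries C ∷ stateSeries D ∷ stateSeries E ∷ []

mahlerRelation : State → Polynomial 6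
mahlerRelation s = stateVar s :+ (stateVar (δ s false) :^ 2 :+ t̂ :* stateVar (δ s true) :^ 2)

mahler-relation : ∀ s → VanishesAt ρ₆ (mahlerRelation s)
mahler-relation A = vanishesAt (≈ₚ⇒+ₚ-vanishes (mahler-equation A))
mahler-relation B = vanishesAt (≈ₚ⇒+ₚ-vanishes (mahler-equation B))
mahler-relation C = vanishesAt (≈ₚ⇒+ₚ-vanishes (mahler-equation C))
mahler-relation D = vanishesAt (≈ₚ⇒+ₚ-vanishes (mahler-equation D))
mahler-relation E = vanishesAt (≈ₚ⇒+ₚ-vanishes (mahler-equation E))

c-as-a a-as-d e-as-d d-quartic : Polynomial 6
c-as-a    = 1ᵖ :+ â :+ ĉ
a-as-d    = â :+ t̂ :* d̂
e-as-d    = t̂ :^ 2 :* ê :+ (1ᵖ :+ d̂ :+ t̂ :* d̂ :^ 2 :+ t̂ :^ 3 :* d̂ :^ 2)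
d-quartic = 1ᵖ :+ t̂ :^ 2 :+ d̂ :^ 2 :+ t̂ :^ 2 :* d̂ :+ t̂ :^ 3 :* d̂ :^ 2 :+ t̂ :^ 2 :* d̂ :^ 4 :+ t̂ :^ 6 :* d̂ :^ 4

c-as-a-vanishes : VanishesAt ρ₆ c-as-a
c-as-a-vanishes = cancel-valuation (â :+ ĉ) {0} ((λ _ ()) , refl)
  (by-certificate ≈ₚ-refl (mahler-relation A ⊕ mahler-relation C))

a-as-d-vanishes : VanishesAt ρ₆ a-as-d
a-as-d-vanishes = cancel-valuation (1ᵖ :+ a-as-d) {0} ((λ _ ()) , refl)
  (by-certificate ≈ₚ-refl (mahler-relation A ⊕ t̂ ⊛ mahler-relation D))

e-as-d-vanishes : VanishesAt ρ₆ e-as-d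
e-as-d-vanishes = by-certificate ≈ₚ-refl
  (mahler-relation D ⊕ mahler-relation B ^⁺ 2 ⊕ c-as-a-vanishes ^⁺ 4 ⊕ a-as-d-vanishes ^⁺ 4
   ⊕ t̂ :^ 2 ⊛ mahler-relation E ^⁺ 2 ⊕ t̂ :^ 2 ⊛ mahler-relation E)

d-quartic-vanishes : VanishesAt ρ₆ d-quartic
d-quartic-vanishes = by-certificate ≈ₚ-refl
  (t̂ :^ 4 ⊛ mahler-relation E ⊕ e-as-d-vanishes ^⁺ 2 ⊕ t̂ :^ 2 ⊛ e-as-d-vanishes)

t²L-valuation : HasValuation (⟦ t̂ :^ 2 :* L t̂ â ⟧ ρ₆) 5
t²L-valuation = below-5 , refl
  where
  below-5 : ∀ i → i < 5 → ⟦ t̂ :^ 2 :* L t̂ â ⟧ ρ₆ i ≡ false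
  below-5 0 _ = refl
  below-5 1 _ = refl
  below-5 2 _ = refl
  below-5 3 _ = refl
  below-5 4 _ = refl
  below-5 (suc (suc (suc (suc (suc _))))) (s≤s (s≤s (s≤s (s≤s (s≤s ())))))

F-vanishes-at-ρ₆ : VanishesAt ρ₆ (F t̂ â)
F-vanishes-at-ρ₆ = cancel-valuation (t̂ :^ 2 :* L t̂ â) t²L-valuation
  (by-certificate ≈ₚ-refl
    (t̂ :^ 4 ⊛ d-quartic-vanishes ⊕ t̂ :^ 2 ⊛ a-as-d-vanishes ^⁺ 2 ⊕ t̂ :^ 5 ⊛ a-as-d-vanishes
     ⊕ t̂ :^ 5 ⊛ a-as-d-vanishes ^⁺ 2 ⊕ t̂ :^ 2 ⊛ a-as-d-vanishes ^⁺ 4 ⊕ t̂ :^ 6 ⊛ a-as-d-vanishes ^⁺ 4))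

F-vanishes-at-σmin : VanishesAt (tₚ ∷ σmin ∷ []) (F x̂ ŷ)
F-vanishes-at-σmin = vanishesAt (vanishes F-vanishes-at-ρ₆)

iter-σmin-constant-term : ∀ k → iter σmin k 0 ≡ false
iter-σmin-constant-term zero    = refl
iter-σmin-constant-term (suc k) = refl

F-vanishes-at-iterates : ∀ k → VanishesAt (iter σmin k ∷ iter σmin (1 + k) ∷ []) (F x̂ ŷ)
F-vanishes-at-iterates k = VanishesAt-∘ₚ (iter σmin k) (iter-σmin-constant-term k) ρ′≈ρ∘τ F-vanishes-at-σmin
  where
  ρ′≈ρ∘τ : ∀ i → lookup (iter σmin k ∷ iter σmin (1 + k) ∷ []) i ≈ₚ (lookup (tₚ ∷ σmin ∷ []) i ∘ₚ iter σmin k)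
  ρ′≈ρ∘τ zero       = ≈ₚ-sym (Composition.tₚ-∘ₚ (iter σmin k) (iter-σmin-constant-term k))
  ρ′≈ρ∘τ (suc zero) = ≈ₚ-refl

H-vanishes-at-iterates : ∀ k → VanishesAt (iter σmin k ∷ iter σmin (1 + k) ∷ iter σmin (2 + k) ∷ []) (H x̂ ẑ)
H-vanishes-at-iterates k = cancel-valuation (H-cofactor x̂ ŷ ẑ) {0} ((λ _ ()) , cofactor₀≡1)
  (by-certificate ≈ₚ-refl (F-cofactor₁ x̂ ŷ ẑ ⊛ F₀₁ ⊕ F-cofactor₂ x̂ ŷ ẑ ⊛ F₁₂))
  where
  ρ : Vec PS 3
  ρ = iter σmin k ∷ iter σmin (1 + k) ∷ iter σmin (2 + k) ∷ []
  F₀₁ : VanishesAt ρ (F x̂ ŷ)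
  F₀₁ = vanishesAt (vanishes (F-vanishes-at-iterates k))
  F₁₂ : VanishesAt ρ (F ŷ ẑ)
  F₁₂ = vanishesAt (vanishes (F-vanishes-at-iterates (1 + k)))
  cofactor₀≡1 : ⟦ H-cofactor x̂ ŷ ẑ ⟧ ρ 0 ≡ true
  cofactor₀≡1 = ⟦⟧-constant-term (H-cofactor x̂ ŷ ẑ) {ρ} λ
    { zero → iter-σmin-constant-term k ; (suc zero) → refl ; (suc (suc zero)) → refl ; (suc (suc (suc ()))) }

H-symmetric : ∀ x y → ⟦ H x̂ ŷ ⟧ (x ∷ y ∷ []) ≈ₚ ⟦ H x̂ ŷ ⟧ (y ∷ x ∷ [])
H-symmetric x y = prove (x ∷ y ∷ []) (H x̂ ŷ) (H ŷ x̂) ≈ₚ-refl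

iter-σmin-4 : iter σmin 4 ≈ₚ tₚ
iter-σmin-4 = +ₚ-vanishes⇒≈ₚ (vanishes s₄+t-vanishes)
  where
  ρ : Vec PS 3
  ρ = iter σmin 2 ∷ iter σmin 4 ∷ tₚ ∷ []
  H₂₄ : VanishesAt ρ (H x̂ ŷ)
  H₂₄ = vanishesAt (vanishes (H-vanishes-at-iterates 2))
  H₂₀ : VanishesAt ρ (H x̂ ẑ)
  H₂₀ = vanishesAt (≈ₚ-trans (H-symmetric (iter σmin 2) tₚ) (vanishes (H-vanishes-at-iterates 0)))
  s₄+t-vanishes : VanishesAt ρ (ŷ :+ ẑ)
  s₄+t-vanishes = cancel-valuation (W x̂ ŷ ẑ) {0} ((λ _ ()) , refl) (by-certificate ≈ₚ-refl (H₂₄ ⊕ H₂₀))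

differ-at : ∀ {f g} n → f n ≢ g n → ¬ (f ≈ₚ g)
differ-at n fn≢gn f≈g = fn≢gn (f≈g n)

iter-σmin-≉-tₚ : ∀ M → 0 < M → M < 4 → ¬ (iter σmin M ≈ₚ tₚ)
iter-σmin-≉-tₚ 1 _ _ = differ-at 2 (λ ())
iter-σmin-≉-tₚ 2 _ _ = differ-at 4 (λ ())
iter-σmin-≉-tₚ 3 _ _ = differ-at 2 (λ ())
iter-σmin-≉-tₚ (suc (suc (suc (suc _)))) _ (s≤s (s≤s (s≤s (s≤s ()))))

σmin-agrees-with-tₚ-below-2 : ∀ m → m < 2 → σmin m ≡ tₚ m
σmin-agrees-with-tₚ-below-2 0 _ = refl
σmin-agrees-with-tₚ-below-2 1 _ = refl
σmin-agrees-with-tₚ-below-2 (suc (suc _)) (s≤s (s≤s ()))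

iter-σmin-2-agrees-with-tₚ-below-4 : ∀ m → m < 4 → iter σmin 2 m ≡ tₚ m
iter-σmin-2-agrees-with-tₚ-below-4 0 _ = refl
iter-σmin-2-agrees-with-tₚ-below-4 1 _ = refl
iter-σmin-2-agrees-with-tₚ-below-4 2 _ = refl
iter-σmin-2-agrees-with-tₚ-below-4 3 _ = refl
iter-σmin-2-agrees-with-tₚ-below-4 (suc (suc (suc (suc _)))) (s≤s (s≤s (s≤s (s≤s ()))))

proposition3p8 : Nottingham σmin × HasOrder σmin 4
                 × HasDepth σmin 1 × HasDepth (iter σmin 2) 3
                 × (σmin 0 ≡ false × σmin 1 ≡ true × σmin 2 ≡ true
                    × σmin 3 ≡ false × σmin 4 ≡ true × σmin 5 ≡ true)
proposition3p8 = (refl , refl)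
               , (iter-σmin-4 , iter-σmin-≉-tₚ)
               , (σmin-agrees-with-tₚ-below-2 , λ ())
               , (iter-σmin-2-agrees-with-tₚ-below-4 , λ ())
               , (refl , refl , refl , refl , refl , refl)
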